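{- For every positive integer $k$ there exists an MSO formula $\varphi_k(X,X_1,\ldots,X_k)$ of length $2^{O(k^2)}$ such that for every graph $G$ and every $Z\subseteq V(G)$, the graph $G[Z]$ is a $k$-letter graph if and only if $G$ satisfies $\varphi_k(Z,Z_1,\ldots,Z_k)$ for some tuple $(Z_1,\ldots,Z_k)$ of pairwise disjoint (possibly empty) subsets of $Z$ with union $Z$.
   Context: A decoder is a directed graph $D=(\Sigma,A)$ (loops allowed) on a finite alphabet. An $n$-vertex graph $H=(V,E)$ is a letter graph over $D$ if there exist $\ell:V\to\Sigma$ and a bijection $c:V\to[n]$ such that two distinct vertices $x,y$ are adjacent iff either $(\ell(x),\ell(y))\in A$ and $c(x)<c(y)$, or $(\ell(y),\ell(x))\in A$ and $c(y)<c(x)$; $H$ is a $k$-letter graph if this holds for some decoder with $|\Sigma|=k$. MSO formulas over graphs are built from atomic formulas $x=y$, $\mathsf{edg}(x,y)$ and $x\in X$ (vertex variables and vertex-set variables) using $\wedge,\vee,\neg$ and existential quantification over both kinds of variables, with the usual semantics. The length of a formula is its number of symbols. -}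

module Defs where

open import Data.Nat using (ℕ; zero; suc; _+_; _<_)
open import Data.Fin using (Fin; toℕ; zero; suc)
open import Data.Fin.Subset using (Subset; _∈_; ∣_∣)
open import Data.Vec using (Vec; _∷_; lookup)
open import Data.Bool using (Bool; true; false)
open import Data.Product using (Σ; Σ-syntax; _×_; _,_; proj₁)
open import Data.Sum using (_⊎_)
open import Relation.Binary.PropositionalEquality using (_≡_; _≢_)
open import Relation.Nullary using (¬_)
open import Function.Bundles using (_⤖_; _⇔_; Bijection)

record Graph : Set where
  field
    n      : ℕ
    adj    : Fin n → Fin n → Bool
    sym    : ∀ x y → adj x y ≡ adj y x
    irrefl : ∀ x → adj x x ≡ false

open Graph public

Edge : (G : Graph) → Fin (n G) → Fin (n G) → Set
Edge G x y = adj G x y ≡ true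

-- Letter graphs.
-- A decoder with alphabet Σ = Fin k is a relation A ⊆ Σ × Σ (loops
-- allowed), represented by its characteristic function.

Decoder : ℕ → Set
Decoder k = Fin k → Fin k → Bool

IsLetterGraphOver : ∀ {k} → Decoder k →
                    (V : Set) (m : ℕ) (E : V → V → Set) → Set
IsLetterGraphOver {k} A V m E =
  Σ (V → Fin k) λ ℓ →
  Σ (V ⤖ Fin m) λ c →
  let f = Bijection.to c in
  ∀ x y → x ≢ y →
    (E x y ⇔ ((A (ℓ x) (ℓ y) ≡ true × toℕ (f x) < toℕ (f y))
            ⊎ (A (ℓ y) (ℓ x) ≡ true × toℕ (f y) < toℕ (f x))))

IsKLetterGraph : ℕ → (V : Set) (m : ℕ) (E : V → V → Set) → Set
IsKLetterGraph k V m E = Σ (Decoder k) λ A → IsLetterGraphOver A V m E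

InducedV : (G : Graph) → Subset (n G) → Set
InducedV G Z = Σ (Fin (n G)) λ x → x ∈ Z

InducedE : (G : Graph) (Z : Subset (n G)) → InducedV G Z → InducedV G Z → Set
InducedE G Z x y = Edge G (proj₁ x) (proj₁ y)

InducedIsKLetter : ℕ → (G : Graph) → Subset (n G) → Set
InducedIsKLetter k G Z = IsKLetterGraph k (InducedV G Z) ∣ Z ∣ (InducedE G Z)

-- MSO formulas, with de Bruijn indices:
-- Formula v s has free vertex variables among Fin v and free
-- vertex-set variables among Fin s.

data Formula : ℕ → ℕ → Set where
  eqF  : ∀ {v s} → Fin v → Fin v → Formula v s
  edgF : ∀ {v s} → Fin v → Fin v → Formula v s
  memF : ∀ {v s} → Fin v → Fin s → Formula v s
  andF : ∀ {v s} → Formula v s → Formula v s → Formula v s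
  orF  : ∀ {v s} → Formula v s → Formula v s → Formula v s
  notF : ∀ {v s} → Formula v s → Formula v s
  exV  : ∀ {v s} → Formula (suc v) s → Formula v s
  exS  : ∀ {v s} → Formula v (suc s) → Formula v s

-- Length = number of symbols (variables count as one symbol each,
-- binary connectives are written with surrounding parentheses).
length : ∀ {v s} → Formula v s → ℕ
length (eqF _ _)  = 3
length (edgF _ _) = 6                     -- edg ( x , y )
length (memF _ _) = 3
length (andF φ ψ) = 3 + length φ + length ψ
length (orF φ ψ)  = 3 + length φ + length ψ
length (notF φ)   = 1 + length φ
length (exV φ)    = 2 + length φ
length (exS φ)    = 2 + length φ

Sat : (G : Graph) → ∀ {v s} → Formula v s →
      Vec (Fin (n G)) v → Vec (Subset (n G)) s → Set
Sat G (eqF x y)  ρ σ = lookup ρ x ≡ lookup ρ y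
Sat G (edgF x y) ρ σ = Edge G (lookup ρ x) (lookup ρ y)
Sat G (memF x X) ρ σ = lookup ρ x ∈ lookup σ X
Sat G (andF φ ψ) ρ σ = Sat G φ ρ σ × Sat G ψ ρ σ
Sat G (orF φ ψ)  ρ σ = Sat G φ ρ σ ⊎ Sat G ψ ρ σ
Sat G (notF φ)   ρ σ = ¬ Sat G φ ρ σ
Sat G (exV φ)    ρ σ = Σ (Fin (n G)) λ x → Sat G φ (x ∷ ρ) σ
Sat G (exS φ)    ρ σ = Σ (Subset (n G)) λ X → Sat G φ ρ (X ∷ σ)

IsPartitionTuple : ∀ {m} k → Subset m → (Fin k → Subset m) → Set
IsPartitionTuple {m} k Z Zs =
  (∀ i x → x ∈ Zs i → x ∈ Z) ×
  (∀ i j → i ≢ j → ∀ x → x ∈ Zs i → ¬ (x ∈ Zs j)) ×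
  (∀ x → x ∈ Z → Σ (Fin k) λ i → x ∈ Zs i)

-- G[Z] is a letter graph over a decoder A, with labelling ℓ and order c, exactly when c is a
-- topological order of the relation "y must precede x": y ≠ x and the adjacency of x and y
-- differs from A (ℓ x) (ℓ y), the value the decoder would give if x came first.  A finite
-- relation has a topological order iff every nonempty subset has a source, and once the
-- labelling is given by the blocks Z₁,…,Z_k this is expressible in MSO.  So φ_k is the
-- disjunction, over all 2^(k²) decoders, of "every nonempty T ⊆ Z contains an element that
-- no y ∈ T must precede".  Taking that disjunction as a balanced tree keeps the depth of φ_k
-- quadratic in k, and a formula of depth d has length at most 8^(d+1).

module Submission where

open import Defs
open import Data.Nat using (ℕ; suc; _≤_; _^_; _*_)
open import Data.Fin using (Fin)
open import Data.Fin.Subset using (Subset)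
open import Data.Vec using (Vec; []; _∷_; tabulate)
open import Data.Product using (Σ; _×_)
open import Function.Bundles using (_⇔_)

open import Data.Bool using (Bool; true; false)
open import Data.Bool.Properties using (¬-not; not-¬; ⇔→≡) renaming (_≟_ to _≟ᵇ_)
open import Data.Empty using (⊥-elim)
open import Data.Fin using (zero; suc; toℕ)
open import Data.Fin.Properties using (_≟_; any?; toℕ-injective)
open import Data.Fin.Subset using (_∈_; _∉_; _⊆_; _-_; Nonempty; ∣_∣)
open import Data.Fin.Subset.Properties
  using (_∈?_; anySubset?; p─⊥≡p; p─q⊆p; x∈p∧x≢y⇒x∈p-y; x∈p⇒∣p-x∣<∣p∣)
open import Data.Nat using (zero; _+_; _<_; _<?_; _⊔_; z≤n; s≤s)
open import Data.Nat.Induction using (<-wellFounded)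
open import Data.Nat.Properties
  using (<-asym; <-cmp; ≮⇒≥; <⇒≱; n≮0; suc-injective; ≤-trans; ≤-reflexive; ⊔-lub; m≤m⊔n; m≤n⊔m;
         m≤m+n; m≤n+m; n≤1+n; +-mono-≤; +-monoʳ-≤; *-monoʳ-≤; ^-monoʳ-≤; m^n>0; +-assoc;
         +-identityʳ; ^-*-assoc; module ≤-Reasoning)
open import Data.Nat.Tactic.RingSolver using (solve-∀)
open import Data.Product using (∃; _,_; proj₁; proj₂)
open import Data.Sum using (_⊎_; inj₁; inj₂; swap)
open import Data.Vec using (here; there; lookup)
open import Data.Vec.Properties using (lookup∘tabulate; []=⇒lookup; lookup⇒[]=)
open import Function using (_∘_; id)
open import Function.Bundles using (_↔_; _⤖_; Inverse; Bijection; Equivalence; mk↔ₛ′; mk⇔)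
open import Function.Properties.Equivalence using () renaming (trans to ⇔-trans; sym to ⇔-sym)
open import Function.Properties.Inverse using (↔⇒⤖)
open import Induction.WellFounded using (Acc; acc)
open import Level using (0ℓ)
open import Relation.Binary.Core using (_⇒_)
open import Relation.Binary.Definitions using (tri<; tri≈; tri>)
open import Relation.Binary.PropositionalEquality
  using (_≡_; _≢_; refl; trans; cong; subst; subst₂; ≢-sym)
import Relation.Binary.PropositionalEquality as ≡
open import Relation.Nullary using (¬_; Dec; yes; no; does; contradiction; Irrelevant)
open import Relation.Nullary.Decidable using (decidable-stable; dec-true; _×-dec_; _⊎-dec_; ¬?)
open import Relation.Unary using (Pred; Decidable)

open Equivalence using (to; from)

El : ∀ {m} → Subset m → Set
El {m} S = Σ (Fin m) (_∈ S)

∈-irrelevant : ∀ {m} {x : Fin m} {p : Subset m} → Irrelevant (x ∈ p)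
∈-irrelevant here      here      = refl
∈-irrelevant (there a) (there b) = cong there (∈-irrelevant a b)

El-≡ : ∀ {m} {S : Subset m} {a b : El S} → proj₁ a ≡ proj₁ b → a ≡ b
El-≡ {a = x , p} {.x , q} refl = cong (x ,_) (∈-irrelevant p q)

x∈p-y⇒x≢y : ∀ {m} {p : Subset m} {x y : Fin m} → x ∈ p - y → x ≢ y
x∈p-y⇒x≢y {p = _ ∷ _} {y = zero}  (there _)   ()
x∈p-y⇒x≢y {p = _ ∷ _} {y = suc _} here        ()
x∈p-y⇒x≢y {p = _ ∷ _} {y = suc _} (there x∈) refl = x∈p-y⇒x≢y x∈ refl

suc∣p-x∣≡∣p∣ : ∀ {m} {p : Subset m} {x} → x ∈ p → suc ∣ p - x ∣ ≡ ∣ p ∣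
suc∣p-x∣≡∣p∣ {p = true ∷ p}  here        = cong (suc ∘ ∣_∣) (p─⊥≡p p)
suc∣p-x∣≡∣p∣ {p = true ∷ p}  (there x∈p) = cong suc (suc∣p-x∣≡∣p∣ x∈p)
suc∣p-x∣≡∣p∣ {p = false ∷ p} (there x∈p) = suc∣p-x∣≡∣p∣ x∈p

∣p∣≡0⇒x∉p : ∀ {m} {p : Subset m} {x} → ∣ p ∣ ≡ 0 → x ∉ p
∣p∣≡0⇒x∉p {p = p} {x} ∣p∣≡0 x∈p = n≮0 (subst (∣ p - x ∣ <_) ∣p∣≡0 (x∈p⇒∣p-x∣<∣p∣ x∈p))

∣p∣≡suc⇒nonempty : ∀ {m} (p : Subset m) {c} → ∣ p ∣ ≡ suc c → Nonempty p
∣p∣≡suc⇒nonempty (true ∷ p)  _ = zero , here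
∣p∣≡suc⇒nonempty (false ∷ p) eq with ∣p∣≡suc⇒nonempty p eq
... | x , x∈p = suc x , there x∈p

∈-tabulate : ∀ {m} {f : Fin m → Bool} {x} → x ∈ tabulate f ⇔ f x ≡ true
∈-tabulate {f = f} {x} = mk⇔ (λ x∈ → trans (≡.sym (lookup∘tabulate f x)) ([]=⇒lookup x∈))
                             (λ fx → lookup⇒[]= x _ (trans (lookup∘tabulate f x) fx))

argmin : ∀ {N} {Q : Pred (Fin N) 0ℓ} → Decidable Q → (key : Fin N → ℕ) →
         ∃ Q → ∃ λ x → Q x × (∀ {y} → Q y → key x ≤ key y)
argmin {N} {Q} Q? key (x , qx) = go x qx (<-wellFounded (key x))
  where
  go : ∀ x → Q x → Acc _<_ (key x) → ∃ λ x → Q x × (∀ {y} → Q y → key x ≤ key y)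
  go x qx (acc smaller) with any? (λ y → Q? y ×-dec key y <? key x)
  ... | yes (y , qy , y<x) = go y qy (smaller y<x)
  ... | no ∄y = x , qx , λ qy → ≮⇒≥ (λ y<x → ∄y (_ , qy , y<x))

module _ {N : ℕ} (R : Fin N → Fin N → Set) where

  Source : Subset N → Fin N → Set
  Source T x = x ∈ T × (∀ {y} → y ∈ T → ¬ R y x)

  HasSources : Subset N → Set
  HasSources S = ∀ T → T ⊆ S → Nonempty T → ∃ (Source T)

  IncreasingOn : (S : Subset N) → (El S → ℕ) → Set
  IncreasingOn S rank = ∀ {a b} → R (proj₁ a) (proj₁ b) → rank a < rank b

  hasSources-⊆ : ∀ {S S′} → S′ ⊆ S → HasSources S → HasSources S′
  hasSources-⊆ S′⊆S sources T T⊆S′ = sources T (S′⊆S ∘ T⊆S′)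

  extendBy0 : ∀ {S} → (El S → ℕ) → Fin N → ℕ
  extendBy0 {S} rank x with x ∈? S
  ... | yes x∈S = rank (x , x∈S)
  ... | no _    = 0

  extendBy0-∈ : ∀ {S} (rank : El S → ℕ) {x} (x∈S : x ∈ S) → extendBy0 rank x ≡ rank (x , x∈S)
  extendBy0-∈ {S} rank {x} x∈S with x ∈? S
  ... | yes x∈S′ = cong (rank ∘ (x ,_)) (∈-irrelevant x∈S′ x∈S)
  ... | no x∉S   = contradiction x∈S x∉S

  -- a minimal-rank element of T is a source
  increasing⇒hasSources : ∀ {S} rank → IncreasingOn S rank → HasSources S
  increasing⇒hasSources rank increasing T T⊆S nonempty with argmin (_∈? T) (extendBy0 rank) nonempty
  ... | x , x∈T , minimal = x , x∈T , λ y∈T Ryx →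
    <⇒≱ (subst₂ _<_ (≡.sym (extendBy0-∈ rank (T⊆S y∈T))) (≡.sym (extendBy0-∈ rank (T⊆S x∈T)))
                     (increasing Ryx))
        (minimal y∈T)

  module _ {S : Subset N} {s : Fin N} (s∈S : s ∈ S) {m : ℕ} (rest : El (S - s) ↔ Fin m) where
    private
      module rest = Inverse rest

    prependTo : El S → Fin (suc m)
    prependTo (x , x∈S) with x ≟ s
    ... | yes _   = zero
    ... | no  x≢s = suc (rest.to (x , x∈p∧x≢y⇒x∈p-y x∈S x≢s))

    prependFrom : Fin (suc m) → El S
    prependFrom zero    = s , s∈S
    prependFrom (suc j) = proj₁ (rest.from j) , p─q⊆p _ _ (proj₂ (rest.from j))

    prependTo∘prependFrom : ∀ j → prependTo (prependFrom j) ≡ j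
    prependTo∘prependFrom zero with s ≟ s
    ... | yes _   = refl
    ... | no  s≢s = contradiction refl s≢s
    prependTo∘prependFrom (suc j) with proj₁ (rest.from j) ≟ s
    ... | yes x≡s = contradiction x≡s (x∈p-y⇒x≢y (proj₂ (rest.from j)))
    ... | no  _   = cong suc (trans (cong rest.to (El-≡ refl)) (rest.strictlyInverseˡ j))

    prependFrom∘prependTo : ∀ a → prependFrom (prependTo a) ≡ a
    prependFrom∘prependTo (x , x∈S) with x ≟ s
    ... | yes refl = El-≡ refl
    ... | no  x≢s  = El-≡ (cong proj₁ (rest.strictlyInverseʳ _))

    prepend : El S ↔ Fin (suc m)
    prepend = mk↔ₛ′ prependTo prependFrom prependTo∘prependFrom prependFrom∘prependTo

    prepend-increasing : (∀ {y} → y ∈ S → ¬ R y s) → IncreasingOn (S - s) (toℕ ∘ rest.to) →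
                         IncreasingOn S (toℕ ∘ prependTo)
    prepend-increasing source increasing {x , x∈S} {y , y∈S} Rxy with x ≟ s | y ≟ s
    ... | _     | yes refl = contradiction Rxy (source x∈S)
    ... | yes _ | no  _    = s≤s z≤n
    ... | no  _ | no  _    = s≤s (increasing Rxy)

  hasSources⇒ordering : ∀ {S} → HasSources S →
                        Σ (El S ↔ Fin ∣ S ∣) λ c → IncreasingOn S (toℕ ∘ Inverse.to c)
  hasSources⇒ordering {S} = go _ S refl
    where
    go : ∀ m S → ∣ S ∣ ≡ m → HasSources S → Σ (El S ↔ Fin m) λ c → IncreasingOn S (toℕ ∘ Inverse.to c)
    go zero S ∣S∣≡0 _ = mk↔ₛ′ (⊥-elim ∘ noElement) (λ ()) (λ ()) (⊥-elim ∘ noElement) ,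
                        λ {a} → ⊥-elim (noElement a)
      where
      noElement : ¬ El S
      noElement (_ , x∈S) = ∣p∣≡0⇒x∉p ∣S∣≡0 x∈S
    go (suc m) S ∣S∣≡1+m sources with sources S id (∣p∣≡suc⇒nonempty S ∣S∣≡1+m)
    ... | s , s∈S , source with go m (S - s) (suc-injective (trans (suc∣p-x∣≡∣p∣ s∈S) ∣S∣≡1+m))
                                  (hasSources-⊆ (p─q⊆p _ _) sources)
    ... | rest , increasing = prepend s∈S rest , prepend-increasing s∈S rest source increasing

hasSources-weaken : ∀ {N} {R R′ : Fin N → Fin N → Set} {S} → R′ ⇒ R → HasSources R S → HasSources R′ S
hasSources-weaken R′⇒R sources T T⊆S nonempty with sources T T⊆S nonempty
... | x , x∈T , source = x , x∈T , λ y∈T → source y∈T ∘ R′⇒R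

true-≡⇔ : ∀ {a b : Bool} → a ≡ b → (a ≡ true ⇔ b ≡ true)
true-≡⇔ a≡b = mk⇔ (trans (≡.sym a≡b)) (trans a≡b)

module LetterOrder {V : Set} (edge : V → V → Bool) {k : ℕ} (A : Decoder k) (ℓ : V → Fin k) where

  -- were y placed before x, the decoder would get the adjacency of x and y wrong
  MustPrecede : V → V → Set
  MustPrecede x y = x ≢ y × edge x y ≢ A (ℓ y) (ℓ x)

  module _ {m : ℕ} (c : V ⤖ Fin m) where

    rank : V → ℕ
    rank = toℕ ∘ Bijection.to c

    rank-injective : ∀ {x y} → rank x ≡ rank y → x ≡ y
    rank-injective = Bijection.injective c ∘ toℕ-injective

    DecodedEdge : V → V → Set
    DecodedEdge x y = (A (ℓ x) (ℓ y) ≡ true × rank x < rank y) ⊎ (A (ℓ y) (ℓ x) ≡ true × rank y < rank x)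

    LetterCondition : Set
    LetterCondition = ∀ x y → x ≢ y → (edge x y ≡ true ⇔ DecodedEdge x y)

    DecidedByEarlier : Set
    DecidedByEarlier = ∀ {x y} → x ≢ y → rank y < rank x → edge x y ≡ A (ℓ y) (ℓ x)

    Increasing : Set
    Increasing = ∀ {x y} → MustPrecede x y → rank x < rank y

    decodedEdge-sym : ∀ {x y} → DecodedEdge x y ⇔ DecodedEdge y x
    decodedEdge-sym = mk⇔ swap swap

    decodedEdge-by-earlier : ∀ {x y} → rank y < rank x → DecodedEdge x y ⇔ A (ℓ y) (ℓ x) ≡ true
    decodedEdge-by-earlier {x} {y} y<x = mk⇔ label-of-earlier (λ A≡true → inj₂ (A≡true , y<x))
      where
      label-of-earlier : DecodedEdge x y → A (ℓ y) (ℓ x) ≡ true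
      label-of-earlier (inj₁ (_ , x<y))    = contradiction x<y (<-asym y<x)
      label-of-earlier (inj₂ (A≡true , _)) = A≡true

    letterCondition⇒decidedByEarlier : LetterCondition → DecidedByEarlier
    letterCondition⇒decidedByEarlier letter x≢y y<x =
      ⇔→≡ (⇔-trans (letter _ _ x≢y) (decodedEdge-by-earlier y<x))

    decidedByEarlier⇒letterCondition : (∀ x y → edge x y ≡ edge y x) → DecidedByEarlier → LetterCondition
    decidedByEarlier⇒letterCondition edge-sym decided x y x≢y with <-cmp (rank x) (rank y)
    ... | tri< x<y _ _ = ⇔-trans (true-≡⇔ (trans (edge-sym x y) (decided (≢-sym x≢y) x<y)))
                                  (⇔-sym (⇔-trans decodedEdge-sym (decodedEdge-by-earlier x<y)))
    ... | tri≈ _ x≈y _ = contradiction (rank-injective x≈y) x≢y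
    ... | tri> _ _ y<x = ⇔-trans (true-≡⇔ (decided x≢y y<x)) (⇔-sym (decodedEdge-by-earlier y<x))

    increasing⇒decidedByEarlier : Increasing → DecidedByEarlier
    increasing⇒decidedByEarlier increasing {x} {y} x≢y y<x =
      decidable-stable (edge x y ≟ᵇ A (ℓ y) (ℓ x)) λ wrong → <-asym y<x (increasing (x≢y , wrong))

    decidedByEarlier⇒increasing : DecidedByEarlier → Increasing
    decidedByEarlier⇒increasing decided {x} {y} (x≢y , wrong) with <-cmp (rank x) (rank y)
    ... | tri< x<y _ _ = x<y
    ... | tri≈ _ x≈y _ = contradiction (rank-injective x≈y) x≢y
    ... | tri> _ _ y<x = contradiction (decided x≢y y<x) wrong

module _ {N k : ℕ} {Z : Subset N} where

  labelledAs : (El Z → Fin k) → Fin k → Fin N → Bool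
  labelledAs ℓ i x with x ∈? Z
  ... | yes x∈Z = does (ℓ (x , x∈Z) ≟ i)
  ... | no  _   = false

  blocks : (El Z → Fin k) → Fin k → Subset N
  blocks ℓ i = tabulate (labelledAs ℓ i)

  ∈-blocks⁻ : ∀ {ℓ i x} → x ∈ blocks ℓ i → Σ (x ∈ Z) λ x∈Z → ℓ (x , x∈Z) ≡ i
  ∈-blocks⁻ {ℓ} {i} {x} x∈ = labelled (to ∈-tabulate x∈)
    where
    labelled : labelledAs ℓ i x ≡ true → Σ (x ∈ Z) λ x∈Z → ℓ (x , x∈Z) ≡ i
    labelled with x ∈? Z
    ... | no _ = λ ()
    ... | yes x∈Z with ℓ (x , x∈Z) ≟ i
    ...   | yes ℓx≡i = λ _ → x∈Z , ℓx≡i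
    ...   | no  _    = λ ()

  ∈-blocks⁺ : ∀ {ℓ x} (x∈Z : x ∈ Z) → x ∈ blocks ℓ (ℓ (x , x∈Z))
  ∈-blocks⁺ {ℓ} {x} x∈Z = from ∈-tabulate labelled
    where
    labelled : labelledAs ℓ (ℓ (x , x∈Z)) x ≡ true
    labelled with x ∈? Z
    ... | yes x∈Z′ rewrite ∈-irrelevant x∈Z′ x∈Z = dec-true (ℓ (x , x∈Z) ≟ _) refl
    ... | no  x∉Z  = contradiction x∈Z x∉Z

  blocks-partition : ∀ ℓ → IsPartitionTuple k Z (blocks ℓ)
  blocks-partition ℓ = (λ _ _ → proj₁ ∘ ∈-blocks⁻) , disjoint , λ _ x∈Z → _ , ∈-blocks⁺ x∈Z
    where
    disjoint : ∀ i j → i ≢ j → ∀ x → x ∈ blocks ℓ i → x ∉ blocks ℓ j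
    disjoint i j i≢j x x∈i x∈j with ∈-blocks⁻ x∈i | ∈-blocks⁻ x∈j
    ... | x∈Z , refl | x∈Z′ , refl = i≢j (cong (ℓ ∘ (x ,_)) (∈-irrelevant x∈Z x∈Z′))

  module _ {Zs : Fin k → Subset N} (partition : IsPartitionTuple k Z Zs) where

    blockOf : El Z → Fin k
    blockOf (x , x∈Z) = proj₁ (proj₂ (proj₂ partition) x x∈Z)

    ∈-blockOf : ∀ a → proj₁ a ∈ Zs (blockOf a)
    ∈-blockOf (x , x∈Z) = proj₂ (proj₂ (proj₂ partition) x x∈Z)

    block-unique : ∀ {x i j} → x ∈ Zs i → x ∈ Zs j → i ≡ j
    block-unique {x} {i} {j} x∈i x∈j =
      decidable-stable (i ≟ j) λ i≢j → proj₁ (proj₂ partition) i j i≢j x x∈i x∈j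

-- MustPrecede on the vertices themselves, with the labels read off the blocks Zs
Precedes : (G : Graph) → ∀ {k} → Decoder k → (Fin k → Subset (n G)) → Fin (n G) → Fin (n G) → Set
Precedes G {k} A Zs y x =
  Σ (Fin k) λ i → Σ (Fin k) λ j → y ∈ Zs i × x ∈ Zs j × y ≢ x × adj G y x ≢ A j i

precedes-cong : ∀ (G : Graph) {k} {A A′ : Decoder k} {Zs Zs′ : Fin k → Subset (n G)} →
                (∀ i j → A i j ≡ A′ i j) → (∀ i → Zs i ≡ Zs′ i) → Precedes G A Zs ⇒ Precedes G A′ Zs′
precedes-cong G A≗A′ Zs≗Zs′ (i , j , y∈ , x∈ , y≢x , wrong) =
  i , j , subst (_ ∈_) (Zs≗Zs′ i) y∈ , subst (_ ∈_) (Zs≗Zs′ j) x∈ , y≢x ,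
  λ agrees → wrong (trans agrees (≡.sym (A≗A′ j i)))

inducedAdj : (G : Graph) (Z : Subset (n G)) → El Z → El Z → Bool
inducedAdj G Z a b = adj G (proj₁ a) (proj₁ b)

module _ (G : Graph) {k : ℕ} (A : Decoder k) {Z : Subset (n G)} {Zs : Fin k → Subset (n G)}
         (partition : IsPartitionTuple k Z Zs) {ℓ : El Z → Fin k} (ℓ∈Zs : ∀ a → proj₁ a ∈ Zs (ℓ a)) where
  open LetterOrder (inducedAdj G Z) A ℓ using (MustPrecede)

  mustPrecede⇒precedes : ∀ {a b} → MustPrecede a b → Precedes G A Zs (proj₁ a) (proj₁ b)
  mustPrecede⇒precedes {a} {b} (a≢b , wrong) = ℓ a , ℓ b , ℓ∈Zs a , ℓ∈Zs b , a≢b ∘ El-≡ , wrong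

  precedes⇒mustPrecede : ∀ {a b} → Precedes G A Zs (proj₁ a) (proj₁ b) → MustPrecede a b
  precedes⇒mustPrecede {a} {b} (i , j , a∈i , b∈j , a≢b , wrong) =
    a≢b ∘ cong proj₁ ,
    subst₂ (λ i j → inducedAdj G Z a b ≢ A j i)
           (block-unique partition a∈i (ℓ∈Zs a)) (block-unique partition b∈j (ℓ∈Zs b)) wrong

Sourced : ∀ {k} (G : Graph) → Subset (n G) → (Fin k → Subset (n G)) → Set
Sourced {k} G Z Zs = ∃ λ (A : Decoder k) → HasSources (Precedes G A Zs) Z

letterGraph⇒sourced : ∀ {k} G Z → InducedIsKLetter k G Z →
                      Σ (Fin k → Subset (n G)) λ Zs → IsPartitionTuple k Z Zs × Sourced G Z Zs
letterGraph⇒sourced G Z (A , ℓ , c , letter) =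
  blocks ℓ , blocks-partition ℓ , A , increasing⇒hasSources _ (rank c) increasing
  where
  open LetterOrder (inducedAdj G Z) A ℓ
  increasing : IncreasingOn (Precedes G A (blocks ℓ)) Z (rank c)
  increasing = decidedByEarlier⇒increasing c (letterCondition⇒decidedByEarlier c letter)
             ∘ precedes⇒mustPrecede G A (blocks-partition ℓ) (∈-blocks⁺ ∘ proj₂)

sourced⇒letterGraph : ∀ {k} G Z {Zs} → IsPartitionTuple k Z Zs → Sourced G Z Zs → InducedIsKLetter k G Z
sourced⇒letterGraph {k} G Z partition (A , sources) with hasSources⇒ordering _ sources
... | c , increasing =
  A , ℓ , ↔⇒⤖ c ,
  decidedByEarlier⇒letterCondition (↔⇒⤖ c) (λ a b → Graph.sym G (proj₁ a) (proj₁ b))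
    (increasing⇒decidedByEarlier (↔⇒⤖ c) (increasing ∘ mustPrecede⇒precedes G A partition (∈-blockOf partition)))
  where
  ℓ : El Z → Fin k
  ℓ = blockOf partition
  open LetterOrder (inducedAdj G Z) A ℓ



infixr 4 _⇒F_

_⇒F_ : ∀ {v s} → Formula v s → Formula v s → Formula v s
φ ⇒F ψ = orF (notF φ) ψ

∀V : ∀ {v s} → Formula (suc v) s → Formula v s
∀V φ = notF (exV (notF φ))

∀S : ∀ {v s} → Formula v (suc s) → Formula v s
∀S φ = notF (exS (notF φ))

-- there are no constants, so falsity needs a vertex variable
⊥F : ∀ {v s} → Formula (suc v) s
⊥F = notF (eqF zero zero)

lit : ∀ {v s} → Bool → Formula v s → Formula v s
lit true  φ = φ
lit false φ = notF φ

∀∈F : ∀ {v s} → Fin s → Formula (suc v) s → Formula v s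
∀∈F X φ = ∀V (memF zero X ⇒F φ)

⋁Fin : ∀ {v s} m → (Fin m → Formula (suc v) s) → Formula (suc v) s
⋁Fin zero    f = ⊥F
⋁Fin (suc m) f = orF (f zero) (⋁Fin m (f ∘ suc))

⋁Bool : ∀ {v s} → (Bool → Formula v s) → Formula v s
⋁Bool f = orF (f false) (f true)

⋁Vec : ∀ {v s} {B : Set} → ((B → Formula v s) → Formula v s) → ∀ m → (Vec B m → Formula v s) → Formula v s
⋁Vec ⋁B zero    f = f []
⋁Vec ⋁B (suc m) f = ⋁B λ b → ⋁Vec ⋁B m (f ∘ (b ∷_))

module _ (G : Graph) where

  sat? : ∀ {v s} (φ : Formula v s) ρ σ → Dec (Sat G φ ρ σ)
  sat? (eqF x y)  ρ σ = lookup ρ x ≟ lookup ρ y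
  sat? (edgF x y) ρ σ = adj G (lookup ρ x) (lookup ρ y) ≟ᵇ true
  sat? (memF x X) ρ σ = lookup ρ x ∈? lookup σ X
  sat? (andF φ ψ) ρ σ = sat? φ ρ σ ×-dec sat? ψ ρ σ
  sat? (orF φ ψ)  ρ σ = sat? φ ρ σ ⊎-dec sat? ψ ρ σ
  sat? (notF φ)   ρ σ = ¬? (sat? φ ρ σ)
  sat? (exV φ)    ρ σ = any? λ x → sat? φ (x ∷ ρ) σ
  sat? (exS φ)    ρ σ = anySubset? λ X → sat? φ ρ (X ∷ σ)

  ⇒F-sat : ∀ {v s} (ρ : Vec (Fin (n G)) v) (σ : Vec (Subset (n G)) s) φ ψ →
           Sat G (φ ⇒F ψ) ρ σ ⇔ (Sat G φ ρ σ → Sat G ψ ρ σ)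
  ⇒F-sat ρ σ φ ψ = mk⇔ modusPonens deduction
    where
    modusPonens : Sat G (φ ⇒F ψ) ρ σ → Sat G φ ρ σ → Sat G ψ ρ σ
    modusPonens (inj₁ ¬φ) φ = contradiction φ ¬φ
    modusPonens (inj₂ ψ)  _ = ψ
    deduction : (Sat G φ ρ σ → Sat G ψ ρ σ) → Sat G (φ ⇒F ψ) ρ σ
    deduction φ→ψ with sat? φ ρ σ
    ... | yes φ = inj₂ (φ→ψ φ)
    ... | no ¬φ = inj₁ ¬φ

  module _ {v s : ℕ} (ρ : Vec (Fin (n G)) v) (σ : Vec (Subset (n G)) s) where

    ∀V-sat : ∀ φ → Sat G (∀V φ) ρ σ ⇔ (∀ x → Sat G φ (x ∷ ρ) σ)
    ∀V-sat φ = mk⇔ (λ ¬∃¬ x → decidable-stable (sat? φ (x ∷ ρ) σ) λ ¬φ → ¬∃¬ (x , ¬φ))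
                   (λ ∀φ (x , ¬φ) → ¬φ (∀φ x))

    ∀S-sat : ∀ φ → Sat G (∀S φ) ρ σ ⇔ (∀ X → Sat G φ ρ (X ∷ σ))
    ∀S-sat φ = mk⇔ (λ ¬∃¬ X → decidable-stable (sat? φ ρ (X ∷ σ)) λ ¬φ → ¬∃¬ (X , ¬φ))
                   (λ ∀φ (X , ¬φ) → ¬φ (∀φ X))

    ∀∈F-sat : ∀ X φ → Sat G (∀∈F X φ) ρ σ ⇔ (∀ {x} → x ∈ lookup σ X → Sat G φ (x ∷ ρ) σ)
    ∀∈F-sat X φ = mk⇔
      (λ h {x} → to (⇒F-sat (x ∷ ρ) σ (memF zero X) φ) (to (∀V-sat (memF zero X ⇒F φ)) h x))
      (λ h → from (∀V-sat (memF zero X ⇒F φ)) λ x → from (⇒F-sat (x ∷ ρ) σ (memF zero X) φ) h)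

    lit-edgF-sat : ∀ b x y → Sat G (lit b (edgF x y)) ρ σ ⇔ adj G (lookup ρ x) (lookup ρ y) ≡ b
    lit-edgF-sat true  x y = mk⇔ (λ e → e) (λ e → e)
    lit-edgF-sat false x y = mk⇔ ¬-not not-¬

    ⋁Bool-sat : ∀ f → Sat G (⋁Bool f) ρ σ ⇔ ∃ λ b → Sat G (f b) ρ σ
    ⋁Bool-sat f = mk⇔ (λ { (inj₁ h) → false , h ; (inj₂ h) → true , h })
                      (λ { (false , h) → inj₁ h ; (true , h) → inj₂ h })

    ⋁Vec-sat : ∀ {B : Set} (⋁B : (B → Formula v s) → Formula v s) →
               (∀ f → Sat G (⋁B f) ρ σ ⇔ ∃ λ b → Sat G (f b) ρ σ) →
               ∀ m f → Sat G (⋁Vec ⋁B m f) ρ σ ⇔ ∃ λ bs → Sat G (f bs) ρ σ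
    ⋁Vec-sat ⋁B ⋁B-sat zero    f = mk⇔ ([] ,_) (λ { ([] , h) → h })
    ⋁Vec-sat ⋁B ⋁B-sat (suc m) f = mk⇔ sound complete
      where
      sound : Sat G (⋁Vec ⋁B (suc m) f) ρ σ → ∃ λ bs → Sat G (f bs) ρ σ
      sound h with to (⋁B-sat _) h
      ... | b , h′ with to (⋁Vec-sat ⋁B ⋁B-sat m (f ∘ (b ∷_))) h′
      ... | bs , h″ = b ∷ bs , h″
      complete : (∃ λ bs → Sat G (f bs) ρ σ) → Sat G (⋁Vec ⋁B (suc m) f) ρ σ
      complete (b ∷ bs , h) = from (⋁B-sat _) (b , from (⋁Vec-sat ⋁B ⋁B-sat m _) (bs , h))

  module _ {v s : ℕ} (ρ : Vec (Fin (n G)) (suc v)) (σ : Vec (Subset (n G)) s) where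

    ⋁Fin-sat : ∀ m f → Sat G (⋁Fin m f) ρ σ ⇔ ∃ λ i → Sat G (f i) ρ σ
    ⋁Fin-sat zero    f = mk⇔ (λ ⊥ → contradiction refl ⊥) (λ ())
    ⋁Fin-sat (suc m) f = mk⇔ sound complete
      where
      sound : Sat G (⋁Fin (suc m) f) ρ σ → ∃ λ i → Sat G (f i) ρ σ
      sound (inj₁ h) = zero , h
      sound (inj₂ h) with to (⋁Fin-sat m (f ∘ suc)) h
      ... | i , h′ = suc i , h′
      complete : (∃ λ i → Sat G (f i) ρ σ) → Sat G (⋁Fin (suc m) f) ρ σ
      complete (zero  , h) = inj₁ h
      complete (suc i , h) = inj₂ (from (⋁Fin-sat m (f ∘ suc)) (i , h))


precedesF : ∀ {v s k} → Decoder k → (Fin k → Fin s) → Fin (suc v) → Fin (suc v) → Formula (suc v) s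
precedesF {k = k} A block y x = ⋁Fin k λ i → ⋁Fin k λ j →
  andF (memF y (block i)) (andF (memF x (block j)) (andF (notF (eqF y x)) (notF (lit (A j i) (edgF y x)))))

-- set variables: T is 0, Z is 1, block i is 2 + i
block : ∀ {k} → Fin k → Fin (suc (suc k))
block i = suc (suc i)

isSourceF : ∀ {k} → Decoder k → Formula 1 (suc (suc k))
isSourceF A = ∀∈F zero (notF (precedesF A block zero (suc zero)))

T⊆ZF T≢∅F : ∀ {k} → Formula 0 (suc (suc k))
T⊆ZF = ∀∈F zero (memF zero (suc zero))
T≢∅F = exV (memF zero zero)

sourceInTF : ∀ {k} → Decoder k → Formula 0 (suc (suc k))
sourceInTF A = exV (andF (memF zero zero) (isSourceF A))

sourceConditionF : ∀ {k} → Decoder k → Formula 0 (suc (suc k))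
sourceConditionF A = T⊆ZF ⇒F T≢∅F ⇒F sourceInTF A

hasSourcesF : ∀ {k} → Decoder k → Formula 0 (suc k)
hasSourcesF A = ∀S (sourceConditionF A)

module _ (G : Graph) {k : ℕ} (A : Decoder k) where

  precedesF-sat : ∀ {v s} (ρ : Vec (Fin (n G)) (suc v)) (σ : Vec (Subset (n G)) s) block y x →
                  Sat G (precedesF A block y x) ρ σ ⇔ Precedes G A (lookup σ ∘ block) (lookup ρ y) (lookup ρ x)
  precedesF-sat ρ σ block y x = mk⇔ sound complete
    where
    sound : Sat G (precedesF A block y x) ρ σ → Precedes G A (lookup σ ∘ block) (lookup ρ y) (lookup ρ x)
    sound h with to (⋁Fin-sat G ρ σ k _) h
    ... | i , h′ with to (⋁Fin-sat G ρ σ k _) h′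
    ... | j , y∈ , x∈ , y≢x , wrong = i , j , y∈ , x∈ , y≢x , wrong ∘ from (lit-edgF-sat G ρ σ (A j i) y x)
    complete : Precedes G A (lookup σ ∘ block) (lookup ρ y) (lookup ρ x) → Sat G (precedesF A block y x) ρ σ
    complete (i , j , y∈ , x∈ , y≢x , wrong) = from (⋁Fin-sat G ρ σ k _)
      (i , from (⋁Fin-sat G ρ σ k _) (j , y∈ , x∈ , y≢x , wrong ∘ to (lit-edgF-sat G ρ σ (A j i) y x)))

  module _ (Z : Subset (n G)) (σ : Vec (Subset (n G)) k) where

    module _ (T : Subset (n G)) where

      private
        env : Vec (Subset (n G)) (suc (suc k))
        env = T ∷ Z ∷ σ

      isSourceF-sat : ∀ x → Sat G (isSourceF A) (x ∷ []) env ⇔ (∀ {y} → y ∈ T → ¬ Precedes G A (lookup σ) y x)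
      isSourceF-sat x = ⇔-trans (∀∈F-sat G (x ∷ []) env zero _)
        (mk⇔ (λ h {y} y∈T → h y∈T ∘ from (yPx-sat y)) (λ h {y} y∈T → h y∈T ∘ to (yPx-sat y)))
        where
        yPx-sat : ∀ y → Sat G (precedesF A block zero (suc zero)) (y ∷ x ∷ []) env ⇔ Precedes G A (lookup σ) y x
        yPx-sat y = precedesF-sat (y ∷ x ∷ []) env block zero (suc zero)

      sourceConditionF-sat : Sat G (sourceConditionF A) [] env ⇔
                             (T ⊆ Z → Nonempty T → ∃ (Source (Precedes G A (lookup σ)) T))
      sourceConditionF-sat = mk⇔ sound complete
        where
        ⊆-sat : Sat G T⊆ZF [] env ⇔ T ⊆ Z
        ⊆-sat = ∀∈F-sat G [] env zero (memF zero (suc zero))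
        outer-sat : Sat G (sourceConditionF A) [] env ⇔ (Sat G T⊆ZF [] env → Sat G (T≢∅F ⇒F sourceInTF A) [] env)
        outer-sat = ⇒F-sat G [] env T⊆ZF (T≢∅F ⇒F sourceInTF A)
        inner-sat : Sat G (T≢∅F ⇒F sourceInTF A) [] env ⇔ (Nonempty T → Sat G (sourceInTF A) [] env)
        inner-sat = ⇒F-sat G [] env T≢∅F (sourceInTF A)
        sound : Sat G (sourceConditionF A) [] env → T ⊆ Z → Nonempty T → ∃ (Source (Precedes G A (lookup σ)) T)
        sound h T⊆Z nonempty with to inner-sat (to outer-sat h (from ⊆-sat T⊆Z)) nonempty
        ... | x , x∈T , source = x , x∈T , to (isSourceF-sat x) source
        complete : (T ⊆ Z → Nonempty T → ∃ (Source (Precedes G A (lookup σ)) T)) → Sat G (sourceConditionF A) [] env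
        complete sources = from outer-sat λ T⊆Z → from inner-sat λ nonempty →
          let (x , x∈T , source) = sources (to ⊆-sat T⊆Z) nonempty
          in x , x∈T , from (isSourceF-sat x) source

    hasSourcesF-sat : Sat G (hasSourcesF A) [] (Z ∷ σ) ⇔ HasSources (Precedes G A (lookup σ)) Z
    hasSourcesF-sat = mk⇔ (λ h T → to (sourceConditionF-sat T) (to ∀T-sat h T))
                          (λ sources → from ∀T-sat λ T → from (sourceConditionF-sat T) (sources T))
      where
      ∀T-sat : Sat G (hasSourcesF A) [] (Z ∷ σ) ⇔ (∀ T → Sat G (sourceConditionF A) [] (T ∷ Z ∷ σ))
      ∀T-sat = ∀S-sat G [] (Z ∷ σ) (sourceConditionF A)

-- The disjunction ranges over tables rather than functions: a table, unlike a function, is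
-- hit literally by the enumeration, and tableOf recovers any decoder pointwise.
decoder : ∀ {k} → Vec (Vec Bool k) k → Decoder k
decoder table i j = lookup (lookup table i) j

tableOf : ∀ {k} → Decoder k → Vec (Vec Bool k) k
tableOf A = tabulate (tabulate ∘ A)

decoder∘tableOf : ∀ {k} (A : Decoder k) i j → decoder (tableOf A) i j ≡ A i j
decoder∘tableOf A i j =
  trans (cong (λ row → lookup row j) (lookup∘tabulate (tabulate ∘ A) i)) (lookup∘tabulate (A i) j)

kLetterFormula : ∀ k → Formula 0 (suc k)
kLetterFormula k = ⋁Vec (⋁Vec ⋁Bool k) k (hasSourcesF ∘ decoder)

module _ (G : Graph) {k : ℕ} (Z : Subset (n G)) (Zs : Fin k → Subset (n G)) where

  private
    σ : Vec (Subset (n G)) (suc k)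
    σ = Z ∷ tabulate Zs

  kLetterFormula-sat : Sat G (kLetterFormula k) [] (Z ∷ tabulate Zs) ⇔ Sourced G Z Zs
  kLetterFormula-sat = mk⇔ sound complete
    where
    tables-sat : Sat G (kLetterFormula k) [] σ ⇔ ∃ λ table → Sat G (hasSourcesF (decoder table)) [] σ
    tables-sat = ⋁Vec-sat G [] σ (⋁Vec ⋁Bool k) (⋁Vec-sat G [] σ ⋁Bool (⋁Bool-sat G [] σ) k) k _
    sound : Sat G (kLetterFormula k) [] σ → Sourced G Z Zs
    sound h with to tables-sat h
    ... | table , h′ =
      decoder table ,
      hasSources-weaken (precedes-cong G (λ _ _ → refl) (≡.sym ∘ lookup∘tabulate Zs))
                        (to (hasSourcesF-sat G (decoder table) Z (tabulate Zs)) h′)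
    complete : Sourced G Z Zs → Sat G (kLetterFormula k) [] σ
    complete (A , sources) =
      from tables-sat (tableOf A , from (hasSourcesF-sat G (decoder (tableOf A)) Z (tabulate Zs))
        (hasSources-weaken (precedes-cong G (decoder∘tableOf A) (lookup∘tabulate Zs)) sources))

depth : ∀ {v s} → Formula v s → ℕ
depth (eqF _ _)  = 0
depth (edgF _ _) = 0
depth (memF _ _) = 0
depth (andF φ ψ) = suc (depth φ ⊔ depth ψ)
depth (orF φ ψ)  = suc (depth φ ⊔ depth ψ)
depth (notF φ)   = suc (depth φ)
depth (exV φ)    = suc (depth φ)
depth (exS φ)    = suc (depth φ)

3+m+n≤8*k : ∀ {k m n} → 1 ≤ k → m ≤ k → n ≤ k → 3 + m + n ≤ 8 * k
3+m+n≤8*k {k} {m} {n} 1≤k m≤k n≤k = begin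
  3 + m + n                  ≤⟨ +-mono-≤ (+-mono-≤ (*-monoʳ-≤ 3 1≤k) m≤k) n≤k ⟩
  3 * k + k + k              ≤⟨ m≤m+n _ (3 * k) ⟩
  3 * k + k + k + 3 * k      ≡⟨ eightfold k ⟩
  8 * k                      ∎
  where
  open ≤-Reasoning
  eightfold : ∀ k → 3 * k + k + k + 3 * k ≡ 8 * k
  eightfold = solve-∀

8^-binary : ∀ {a b} da db → a ≤ 8 ^ suc da → b ≤ 8 ^ suc db → 3 + a + b ≤ 8 ^ suc (suc (da ⊔ db))
8^-binary da db a≤ b≤ = 3+m+n≤8*k (m^n>0 8 (suc (da ⊔ db)))
  (≤-trans a≤ (^-monoʳ-≤ 8 (s≤s (m≤m⊔n da db))))
  (≤-trans b≤ (^-monoʳ-≤ 8 (s≤s (m≤n⊔m da db))))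

8^-unary : ∀ {a} d → a ≤ 8 ^ suc d → 2 + a ≤ 8 ^ suc (suc d)
8^-unary {a} d a≤ =
  ≤-trans (≤-trans (n≤1+n (2 + a)) (≤-reflexive (≡.sym (+-identityʳ (3 + a)))))
          (3+m+n≤8*k (m^n>0 8 (suc d)) a≤ z≤n)

length≤8^suc-depth : ∀ {v s} (φ : Formula v s) → length φ ≤ 8 ^ suc (depth φ)
length≤8^suc-depth (eqF _ _)  = m≤m+n 3 5
length≤8^suc-depth (edgF _ _) = m≤m+n 6 2
length≤8^suc-depth (memF _ _) = m≤m+n 3 5
length≤8^suc-depth (andF φ ψ) = 8^-binary (depth φ) (depth ψ) (length≤8^suc-depth φ) (length≤8^suc-depth ψ)
length≤8^suc-depth (orF φ ψ)  = 8^-binary (depth φ) (depth ψ) (length≤8^suc-depth φ) (length≤8^suc-depth ψ)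
length≤8^suc-depth (notF φ)   = ≤-trans (n≤1+n _) (8^-unary (depth φ) (length≤8^suc-depth φ))
length≤8^suc-depth (exV φ)    = 8^-unary (depth φ) (length≤8^suc-depth φ)
length≤8^suc-depth (exS φ)    = 8^-unary (depth φ) (length≤8^suc-depth φ)

depth-⋁Fin : ∀ {v s} m (f : Fin m → Formula (suc v) s) {d} →
             (∀ i → depth (f i) ≤ d) → depth (⋁Fin m f) ≤ m + suc d
depth-⋁Fin zero    f     _     = s≤s z≤n
depth-⋁Fin (suc m) f {d} bound =
  s≤s (⊔-lub (≤-trans (bound zero) (≤-trans (n≤1+n d) (m≤n+m (suc d) m)))
             (depth-⋁Fin m (f ∘ suc) (bound ∘ suc)))

depth-⋁Bool : ∀ {v s} (f : Bool → Formula v s) {d} → (∀ b → depth (f b) ≤ d) → depth (⋁Bool f) ≤ 1 + d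
depth-⋁Bool f bound = s≤s (⊔-lub (bound false) (bound true))

depth-⋁Vec : ∀ {v s} {B : Set} (⋁B : (B → Formula v s) → Formula v s) c →
             (∀ f {d} → (∀ b → depth (f b) ≤ d) → depth (⋁B f) ≤ c + d) →
             ∀ m f {d} → (∀ bs → depth (f bs) ≤ d) → depth (⋁Vec ⋁B m f) ≤ m * c + d
depth-⋁Vec ⋁B c ⋁B-depth zero    f     bound = bound []
depth-⋁Vec ⋁B c ⋁B-depth (suc m) f {d} bound =
  ≤-trans (⋁B-depth _ λ b → depth-⋁Vec ⋁B c ⋁B-depth m (f ∘ (b ∷_)) (bound ∘ (b ∷_)))
          (≤-reflexive (≡.sym (+-assoc c (m * c) d)))

depth-precedesF : ∀ {v s k} (A : Decoder k) (block : Fin k → Fin s) (y x : Fin (suc v)) →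
                  depth (precedesF A block y x) ≤ k + suc (k + 6)
depth-precedesF {k = k} A block y x =
  depth-⋁Fin k _ λ i → depth-⋁Fin k _ λ j → s≤s (s≤s (s≤s (s≤s (depth-lit (A j i)))))
  where
  depth-lit : ∀ b → depth (lit b (edgF {s = _} y x)) ≤ 1
  depth-lit true  = z≤n
  depth-lit false = s≤s z≤n

-- definitionally, hasSourcesF A is 12 levels deeper than its precedesF subformula
depth-hasSourcesF : ∀ {k} (A : Decoder k) → depth (hasSourcesF A) ≤ 12 + (k + suc (k + 6))
depth-hasSourcesF A = +-monoʳ-≤ 12 (depth-precedesF A block zero (suc zero))

depth-kLetterFormula : ∀ k → depth (kLetterFormula k) ≤ k * (k * 1) + (12 + (k + suc (k + 6)))
depth-kLetterFormula k =
  depth-⋁Vec (⋁Vec ⋁Bool k) (k * 1) (depth-⋁Vec ⋁Bool 1 depth-⋁Bool k) k _ (depth-hasSourcesF ∘ decoder)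

kLetterFormula-length : ∀ {k} → 1 ≤ k → length (kLetterFormula k) ≤ 2 ^ (69 * k * k)
kLetterFormula-length {k@(suc j)} _ = begin
  length (kLetterFormula k)           ≤⟨ length≤8^suc-depth (kLetterFormula k) ⟩
  8 ^ suc (depth (kLetterFormula k))  ≤⟨ ^-monoʳ-≤ 8 {suc (depth (kLetterFormula k))} exponent ⟩
  8 ^ (23 * (k * k))                  ≡⟨ ^-*-assoc 2 3 (23 * (k * k)) ⟩
  2 ^ (3 * (23 * (k * k)))            ≡⟨ cong (2 ^_) (cubed j) ⟩
  2 ^ (69 * k * k)                    ∎
  where
  open ≤-Reasoning
  quadratic : ∀ j → suc (suc j * (suc j * 1) + (12 + (suc j + suc (suc j + 6)))) + (22 * (j * j) + 42 * j)
                    ≡ 23 * (suc j * suc j)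
  quadratic = solve-∀
  cubed : ∀ j → 3 * (23 * (suc j * suc j)) ≡ 69 * suc j * suc j
  cubed = solve-∀
  exponent : suc (depth (kLetterFormula k)) ≤ 23 * (k * k)
  exponent = ≤-trans (s≤s (depth-kLetterFormula k)) (≤-trans (m≤m+n _ _) (≤-reflexive (quadratic j)))

kLetterFormula-characterises : ∀ {k} G Z →
  InducedIsKLetter k G Z ⇔
  Σ (Fin k → Subset (n G)) λ Zs → IsPartitionTuple k Z Zs × Sat G (kLetterFormula k) [] (Z ∷ tabulate Zs)
kLetterFormula-characterises G Z = mk⇔
  (λ letter → let (Zs , partition , sourced) = letterGraph⇒sourced G Z letter
              in Zs , partition , from (kLetterFormula-sat G Z Zs) sourced)
  (λ (Zs , partition , sat) → sourced⇒letterGraph G Z partition (to (kLetterFormula-sat G Z Zs) sat))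

theorem3p4 : Σ ℕ λ C → (k : ℕ) → 1 ≤ k →
    Σ (Formula 0 (suc k)) λ φ →
      (length φ ≤ 2 ^ (C * k * k)) ×
      ((G : Graph) (Z : Subset (n G)) →
        (InducedIsKLetter k G Z ⇔
          Σ (Fin k → Subset (n G)) λ Zs →
            IsPartitionTuple k Z Zs × Sat G φ [] (Z ∷ tabulate Zs)))
theorem3p4 = 69 , λ k 1≤k → kLetterFormula k , kLetterFormula-length 1≤k , kLetterFormula-characterises
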